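{- Let $1\le \ell\le n/2$. Any adaptive deterministic group testing algorithm that receives no information about $d=|I|$ and that, for every defective set $I\subseteq[n]$ with $\ell\le |I|\le n/2$, outputs a set $L\subseteq I$ with $|L|=\ell$, must make (on some such input) at least $\ell\log(n/\ell)$ tests.
   Context: Group testing model: the items are $[n]=\{1,\dots,n\}$ and there is an unknown set $I\subseteq[n]$ of defective items, $d=|I|$. A test is a subset $Q\subseteq[n]$, and its answer is $T_I(Q)=1$ if $Q\cap I\neq\emptyset$ and $T_I(Q)=0$ otherwise; the algorithm accesses $I$ only through test answers. An adaptive algorithm may choose each test depending on the answers to previous tests. All logarithms are base 2. -}

module Defs where

open import Data.Nat using (ℕ; zero; suc; _+_)
open import Data.Bool using (Bool; true; false)
open import Data.Product using (_×_; _,_)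
open import Data.Fin.Subset using (Subset; _∩_)
open import Data.Fin.Subset.Properties using (nonempty?)
open import Relation.Nullary using (does)

testAnswer : ∀ {n} → Subset n → Subset n → Bool
testAnswer I Q = does (nonempty? (Q ∩ I))

-- An adaptive deterministic group testing algorithm on items Fin n,
-- receiving no information about |I|: a decision tree.
data Alg (n : ℕ) : Set where
  output : Subset n → Alg n
  test   : (Q : Subset n) → (on0 on1 : Alg n) → Alg n

run : ∀ {n} → Alg n → Subset n → Subset n × ℕ
run (output L) I = L , 0
run (test Q a0 a1) I with testAnswer I Q
... | false = let (L , t) = run a0 I in L , suc t
... | true  = let (L , t) = run a1 I in L , suc t

result : ∀ {n} → Alg n → Subset n → Subset n
result A I = Data.Product.proj₁ (run A I)

numTests : ∀ {n} → Alg n → Subset n → ℕ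
numTests A I = Data.Product.proj₂ (run A I)

-- A correct algorithm must output I itself whenever |I| = ℓ, so it distinguishes
-- all C(n, ℓ) subsets of size ℓ.  An adversary answering every test so as to keep
-- the larger half of the still-consistent candidates then forces some input to
-- cost at least log C(n, ℓ) tests, and C(n, ℓ) ℓ^ℓ ≥ n^ℓ follows by induction from
-- (k+1) C(n+1, k+1) = (n+1) C(n, k) and ((n+1) k)^k ≤ (n (k+1))^k for k ≤ n.
module Submission where

open import Defs
open import Data.Bool using (Bool; true; false; if_then_else_)
import Data.Bool as Bool
open import Data.Fin.Subset using (Subset; _⊆_; ∣_∣; inside; outside)
open import Data.Fin.Subset.Properties using (_∈?_; ⊆-antisym; p⊂q⇒∣p∣<∣q∣)
open import Data.List using (List; []; _∷_; map; _++_; length; filter)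
open import Data.List.Properties using (length-map; length-++)
import Data.List.Membership.Propositional as List
open import Data.List.Membership.Propositional.Properties using (∈-map⁻; ∈-filter⁻)
open import Data.List.Relation.Binary.Disjoint.Propositional using (Disjoint)
open import Data.List.Relation.Unary.All as All using (All)
import Data.List.Relation.Unary.All.Properties as Allₚ
open import Data.List.Relation.Unary.AllPairs using ([]; _∷_)
open import Data.List.Relation.Unary.Any using (here; there)
open import Data.List.Relation.Unary.Unique.Propositional using (Unique)
import Data.List.Relation.Unary.Unique.Propositional.Properties as Unique
open import Data.Nat using (ℕ; zero; suc; _+_; _*_; _^_; _≤_; _<_; z≤n; s≤s; >-nonZero)
open import Data.Nat.Combinatorics using (_C_; nC1≡n; nCk+nC[k+1]≡[n+1]C[k+1]; k>n⇒nCk≡0)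
open import Data.Nat.Properties
open import Algebra.Properties.CommutativeSemigroup *-commutativeSemigroup using (interchange; xy∙z≈xz∙y)
open import Data.Product using (_×_; ∃; _,_)
open import Data.Sum using (inj₁; inj₂)
open import Data.Vec using (_∷_)
import Data.Vec as Vec
open import Data.Vec.Properties using (∷-injectiveʳ)
open import Relation.Binary.PropositionalEquality using (_≡_; refl; sym; trans; cong; cong₂; subst; module ≡-Reasoning)
open import Relation.Nullary using (yes; no; contradiction)

[k+1]*[n+1]C[k+1]≡[n+1]*nCk : ∀ n k → suc k * (suc n C suc k) ≡ suc n * (n C k)
[k+1]*[n+1]C[k+1]≡[n+1]*nCk zero zero = refl
[k+1]*[n+1]C[k+1]≡[n+1]*nCk zero (suc k) =
  trans (cong (suc (suc k) *_) (k>n⇒nCk≡0 {1} {suc (suc k)} (s≤s (s≤s z≤n)))) (*-zeroʳ (suc (suc k)))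
[k+1]*[n+1]C[k+1]≡[n+1]*nCk (suc n) zero =
  trans (*-identityˡ (suc (suc n) C 1)) (trans (nC1≡n (suc (suc n))) (cong suc (sym (*-identityʳ (suc n)))))
[k+1]*[n+1]C[k+1]≡[n+1]*nCk (suc n) (suc k) = begin
  suc (suc k) * (suc (suc n) C suc (suc k))      ≡⟨ cong (suc (suc k) *_) (sym (nCk+nC[k+1]≡[n+1]C[k+1] (suc n) (suc k))) ⟩
  suc (suc k) * (x + y)                          ≡⟨ *-distribˡ-+ (suc (suc k)) x y ⟩
  (x + suc k * x) + suc (suc k) * y              ≡⟨ cong₂ (λ u v → (x + u) + v) ([k+1]*[n+1]C[k+1]≡[n+1]*nCk n k)
                                                                                 ([k+1]*[n+1]C[k+1]≡[n+1]*nCk n (suc k)) ⟩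
  (x + suc n * (n C k)) + suc n * (n C suc k)    ≡⟨ +-assoc x (suc n * (n C k)) (suc n * (n C suc k)) ⟩
  x + (suc n * (n C k) + suc n * (n C suc k))    ≡⟨ cong (x +_) (sym (*-distribˡ-+ (suc n) (n C k) (n C suc k))) ⟩
  x + suc n * (n C k + n C suc k)                ≡⟨ cong (λ c → x + suc n * c) (nCk+nC[k+1]≡[n+1]C[k+1] n k) ⟩
  suc (suc n) * (suc n C suc k)                  ∎
  where
  open ≡-Reasoning
  x = suc n C suc k
  y = suc n C suc (suc k)

^-distrib-* : ∀ m n k → (m * n) ^ k ≡ m ^ k * n ^ k
^-distrib-* m n zero = refl
^-distrib-* m n (suc k) = trans (cong ((m * n) *_) (^-distrib-* m n k)) (interchange m n (m ^ k) (n ^ k))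

nCk>0 : ∀ {n k} → k ≤ n → 0 < n C k
nCk>0 {k = zero} _ = s≤s z≤n
nCk>0 {suc n} {suc k} (s≤s k≤n) =
  subst (0 <_) (nCk+nC[k+1]≡[n+1]C[k+1] n k) (<-≤-trans (nCk>0 k≤n) (m≤m+n (n C k) (n C suc k)))

n^k≤nCk*k^k : ∀ {n k} → k ≤ n → n ^ k ≤ (n C k) * k ^ k
n^k≤nCk*k^k {n} {zero} _ = ≤-refl
n^k≤nCk*k^k {suc m} {suc j} (s≤s j≤m) = begin
  suc m * suc m ^ j                      ≤⟨ *-monoʳ-≤ (suc m) [m+1]^j≤mCj*[j+1]^j ⟩
  suc m * ((m C j) * suc j ^ j)          ≡⟨ sym (*-assoc (suc m) (m C j) (suc j ^ j)) ⟩
  suc m * (m C j) * suc j ^ j            ≡⟨ cong (_* suc j ^ j) (sym ([k+1]*[n+1]C[k+1]≡[n+1]*nCk m j)) ⟩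
  suc j * (suc m C suc j) * suc j ^ j    ≡⟨ cong (_* suc j ^ j) (*-comm (suc j) (suc m C suc j)) ⟩
  (suc m C suc j) * suc j * suc j ^ j    ≡⟨ *-assoc (suc m C suc j) (suc j) (suc j ^ j) ⟩
  (suc m C suc j) * (suc j * suc j ^ j)  ∎
  where
  open ≤-Reasoning
  [m+1]*j≤m*[j+1] : suc m * j ≤ m * suc j
  [m+1]*j≤m*[j+1] = ≤-trans (+-monoˡ-≤ (m * j) j≤m) (≤-reflexive (sym (*-suc m j)))
  i^i>0 : ∀ i → 0 < i ^ i
  i^i>0 zero    = s≤s z≤n
  i^i>0 (suc i) = m^n>0 (suc i) (suc i)
  [m+1]^j≤mCj*[j+1]^j : suc m ^ j ≤ (m C j) * suc j ^ j
  [m+1]^j≤mCj*[j+1]^j = *-cancelʳ-≤ (suc m ^ j) ((m C j) * suc j ^ j) (j ^ j) {{>-nonZero (i^i>0 j)}} (begin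
    suc m ^ j * j ^ j            ≡⟨ sym (^-distrib-* (suc m) j j) ⟩
    (suc m * j) ^ j              ≤⟨ ^-monoˡ-≤ j [m+1]*j≤m*[j+1] ⟩
    (m * suc j) ^ j              ≡⟨ ^-distrib-* m (suc j) j ⟩
    m ^ j * suc j ^ j            ≤⟨ *-monoˡ-≤ (suc j ^ j) (n^k≤nCk*k^k j≤m) ⟩
    (m C j) * j ^ j * suc j ^ j  ≡⟨ xy∙z≈xz∙y (m C j) (j ^ j) (suc j ^ j) ⟩
    (m C j) * suc j ^ j * j ^ j  ∎)

p⊆q∧∣p∣≡∣q∣⇒p≡q : ∀ {n} {p q : Subset n} → p ⊆ q → ∣ p ∣ ≡ ∣ q ∣ → p ≡ q
p⊆q∧∣p∣≡∣q∣⇒p≡q {p = p} {q} p⊆q ∣p∣≡∣q∣ = ⊆-antisym p⊆q q⊆p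
  where
  q⊆p : q ⊆ p
  q⊆p {x} x∈q with x ∈? p
  ... | yes x∈p = x∈p
  ... | no  x∉p = contradiction ∣p∣≡∣q∣ (<⇒≢ (p⊂q⇒∣p∣<∣q∣ (p⊆q , x , x∈q , x∉p)))

subsetsOfSize : ∀ n → ℕ → List (Subset n)
subsetsOfSize zero    zero    = Vec.[] ∷ []
subsetsOfSize zero    (suc k) = []
subsetsOfSize (suc n) zero    = map (outside ∷_) (subsetsOfSize n zero)
subsetsOfSize (suc n) (suc k) =
  map (inside ∷_) (subsetsOfSize n k) ++ map (outside ∷_) (subsetsOfSize n (suc k))

length-subsetsOfSize : ∀ n k → length (subsetsOfSize n k) ≡ n C k
length-subsetsOfSize zero    zero    = refl
length-subsetsOfSize zero    (suc k) = refl
length-subsetsOfSize (suc n) zero    =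
  trans (length-map (outside ∷_) (subsetsOfSize n zero)) (length-subsetsOfSize n zero)
length-subsetsOfSize (suc n) (suc k) = begin
  length (map (inside ∷_) (subsetsOfSize n k) ++ map (outside ∷_) (subsetsOfSize n (suc k)))
    ≡⟨ length-++ (map (inside ∷_) (subsetsOfSize n k)) ⟩
  length (map (inside ∷_) (subsetsOfSize n k)) + length (map (outside ∷_) (subsetsOfSize n (suc k)))
    ≡⟨ cong₂ _+_ (length-map (inside ∷_) (subsetsOfSize n k)) (length-map (outside ∷_) (subsetsOfSize n (suc k))) ⟩
  length (subsetsOfSize n k) + length (subsetsOfSize n (suc k))
    ≡⟨ cong₂ _+_ (length-subsetsOfSize n k) (length-subsetsOfSize n (suc k)) ⟩
  n C k + n C suc k
    ≡⟨ nCk+nC[k+1]≡[n+1]C[k+1] n k ⟩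
  suc n C suc k ∎
  where open ≡-Reasoning

subsetsOfSize-sized : ∀ n k → All (λ p → ∣ p ∣ ≡ k) (subsetsOfSize n k)
subsetsOfSize-sized zero    zero    = refl All.∷ All.[]
subsetsOfSize-sized zero    (suc k) = All.[]
subsetsOfSize-sized (suc n) zero    = Allₚ.map⁺ (subsetsOfSize-sized n zero)
subsetsOfSize-sized (suc n) (suc k) =
  Allₚ.++⁺ (Allₚ.map⁺ (All.map (cong suc) (subsetsOfSize-sized n k)))
           (Allₚ.map⁺ (subsetsOfSize-sized n (suc k)))

subsetsOfSize-unique : ∀ n k → Unique (subsetsOfSize n k)
subsetsOfSize-unique zero    zero    = All.[] ∷ []
subsetsOfSize-unique zero    (suc k) = []
subsetsOfSize-unique (suc n) zero    = Unique.map⁺ ∷-injectiveʳ (subsetsOfSize-unique n zero)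
subsetsOfSize-unique (suc n) (suc k) =
  Unique.++⁺ (Unique.map⁺ ∷-injectiveʳ (subsetsOfSize-unique n k))
             (Unique.map⁺ ∷-injectiveʳ (subsetsOfSize-unique n (suc k)))
             inside∷-disjoint-outside∷
  where
  inside∷-disjoint-outside∷ : Disjoint (map (inside ∷_) (subsetsOfSize n k))
                                       (map (outside ∷_) (subsetsOfSize n (suc k)))
  inside∷-disjoint-outside∷ (v∈inside∷ , v∈outside∷)
    with ∈-map⁻ (inside ∷_) v∈inside∷ | ∈-map⁻ (outside ∷_) v∈outside∷
  ... | _ , _ , refl | _ , _ , ()

length≡length-filter-false+length-filter-true : ∀ {a} {A : Set a} (f : A → Bool) xs →
  length xs ≡ length (filter (λ x → f x Bool.≟ false) xs) + length (filter (λ x → f x Bool.≟ true) xs)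
length≡length-filter-false+length-filter-true f [] = refl
length≡length-filter-false+length-filter-true f (x ∷ xs) with f x
... | false = cong suc (length≡length-filter-false+length-filter-true f xs)
... | true  = trans (cong suc (length≡length-filter-false+length-filter-true f xs)) (sym (+-suc _ _))

∃-large-fibre : ∀ {a} {A : Set a} (f : A → Bool) xs →
  ∃ λ b → length xs ≤ 2 * length (filter (λ x → f x Bool.≟ b) xs)
∃-large-fibre f xs with ≤-total (length (filter (λ x → f x Bool.≟ false) xs))
                                (length (filter (λ x → f x Bool.≟ true) xs))
... | inj₁ f≤t = true  , ≤-trans (≤-reflexive (length≡length-filter-false+length-filter-true f xs))
                                 (+-mono-≤ f≤t (≤-reflexive (sym (+-identityʳ _))))
... | inj₂ t≤f = false , ≤-trans (≤-reflexive (length≡length-filter-false+length-filter-true f xs))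
                                 (+-monoʳ-≤ _ (≤-trans t≤f (≤-reflexive (sym (+-identityʳ _)))))

result-test : ∀ {n} {Q I : Subset n} {a₀ a₁ : Alg n} {b} → testAnswer I Q ≡ b →
  result (test Q a₀ a₁) I ≡ result (if b then a₁ else a₀) I
result-test {Q = Q} {I} refl with testAnswer I Q
... | false = refl
... | true  = refl

numTests-test : ∀ {n} {Q I : Subset n} {a₀ a₁ : Alg n} {b} → testAnswer I Q ≡ b →
  numTests (test Q a₀ a₁) I ≡ suc (numTests (if b then a₁ else a₀) I)
numTests-test {Q = Q} {I} refl with testAnswer I Q
... | false = refl
... | true  = refl

Distinguishes : ∀ {n} → Alg n → List (Subset n) → Set
Distinguishes A F = ∀ {I J} → I List.∈ F → J List.∈ F → result A I ≡ result A J → I ≡ J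

InformationBound : ∀ {n} → Alg n → Set
InformationBound {n} A = (F : List (Subset n)) → Unique F → Distinguishes A F →
  0 < length F → ∃ λ I → I List.∈ F × length F ≤ 2 ^ numTests A I

informationBound-output : ∀ {n} (L : Subset n) → InformationBound (output L)
informationBound-output L []          _                      _             ()
informationBound-output L (I ∷ [])    _                      _             _ = I , here refl , ≤-refl
informationBound-output L (I ∷ J ∷ F) ((I≢J All.∷ _) ∷ _) distinguishes _ =
  contradiction (distinguishes (here refl) (there (here refl)) refl) I≢J

informationBound-test : ∀ {n} {Q : Subset n} {a₀ a₁ : Alg n} →
  InformationBound a₀ → InformationBound a₁ → InformationBound (test Q a₀ a₁)
informationBound-test {Q = Q} {a₀} {a₁} bound₀ bound₁ F unique distinguishes 0<|F|
  with b , |F|≤2*|F′| ← ∃-large-fibre (λ I → testAnswer I Q) F =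
  let I , I∈F′ , |F′|≤2^t = bound b F′ (Unique.filter⁺ answers-b? unique) distinguishes′ 0<|F′|
      I∈F , answer = ∈-filter⁻ answers-b? I∈F′
  in I , I∈F , (begin
       length F                                    ≤⟨ |F|≤2*|F′| ⟩
       2 * length F′                               ≤⟨ *-monoʳ-≤ 2 |F′|≤2^t ⟩
       2 ^ suc (numTests (if b then a₁ else a₀) I) ≡⟨ cong (2 ^_) (sym (numTests-test answer)) ⟩
       2 ^ numTests (test Q a₀ a₁) I               ∎)
  where
  open ≤-Reasoning
  bound : ∀ b → InformationBound (if b then a₁ else a₀)
  bound false = bound₀
  bound true  = bound₁
  answers-b? = λ I → testAnswer I Q Bool.≟ b
  F′ = filter answers-b? F
  distinguishes′ : Distinguishes (if b then a₁ else a₀) F′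
  distinguishes′ I∈F′ J∈F′ same-result
    with I∈F , I-answer ← ∈-filter⁻ answers-b? I∈F′
       | J∈F , J-answer ← ∈-filter⁻ answers-b? J∈F′ =
    distinguishes I∈F J∈F (trans (result-test I-answer) (trans same-result (sym (result-test J-answer))))
  0<|F′| : 0 < length F′
  0<|F′| = *-cancelˡ-< 2 0 (length F′) (≤-trans 0<|F| |F|≤2*|F′|)

informationBound : ∀ {n} (A : Alg n) → InformationBound A
informationBound (output L)     = informationBound-output L
informationBound (test Q a₀ a₁) = informationBound-test (informationBound a₀) (informationBound a₁)

theorem3 : (n ℓ : ℕ) → 1 ≤ ℓ → 2 * ℓ ≤ n → (A : Alg n) →
    ((I : Subset n) → ℓ ≤ ∣ I ∣ → 2 * ∣ I ∣ ≤ n →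
      (result A I ⊆ I) × (∣ result A I ∣ ≡ ℓ)) →
    ∃ λ (I : Subset n) → (ℓ ≤ ∣ I ∣) × (2 * ∣ I ∣ ≤ n) ×
      (n ^ ℓ ≤ 2 ^ numTests A I * ℓ ^ ℓ)
theorem3 n ℓ _ 2ℓ≤n A correct =
  let I , I∈F , |F|≤2^t = informationBound A F (subsetsOfSize-unique n ℓ) distinguishes
                            (subst (0 <_) (sym (length-subsetsOfSize n ℓ)) (nCk>0 ℓ≤n))
      ℓ≤∣I∣ , 2∣I∣≤n = admissible I∈F
  in I , ℓ≤∣I∣ , 2∣I∣≤n , (begin
       n ^ ℓ                     ≤⟨ n^k≤nCk*k^k ℓ≤n ⟩
       (n C ℓ) * ℓ ^ ℓ           ≡⟨ cong (_* ℓ ^ ℓ) (sym (length-subsetsOfSize n ℓ)) ⟩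
       length F * ℓ ^ ℓ          ≤⟨ *-monoˡ-≤ (ℓ ^ ℓ) |F|≤2^t ⟩
       2 ^ numTests A I * ℓ ^ ℓ  ∎)
  where
  open ≤-Reasoning
  F = subsetsOfSize n ℓ
  ℓ≤n : ℓ ≤ n
  ℓ≤n = ≤-trans (m≤m+n ℓ (ℓ + 0)) 2ℓ≤n
  size : ∀ {I} → I List.∈ F → ∣ I ∣ ≡ ℓ
  size = All.lookup (subsetsOfSize-sized n ℓ)
  admissible : ∀ {I} → I List.∈ F → ℓ ≤ ∣ I ∣ × 2 * ∣ I ∣ ≤ n
  admissible I∈F = ≤-reflexive (sym (size I∈F)) , subst (λ k → 2 * k ≤ n) (sym (size I∈F)) 2ℓ≤n
  outputs-input : ∀ {I} → I List.∈ F → result A I ≡ I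
  outputs-input {I} I∈F =
    let ℓ≤∣I∣ , 2∣I∣≤n = admissible I∈F
        L⊆I , ∣L∣≡ℓ = correct I ℓ≤∣I∣ 2∣I∣≤n
    in p⊆q∧∣p∣≡∣q∣⇒p≡q L⊆I (trans ∣L∣≡ℓ (sym (size I∈F)))
  distinguishes : Distinguishes A F
  distinguishes I∈F J∈F same-result =
    trans (sym (outputs-input I∈F)) (trans same-result (outputs-input J∈F))
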